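{- For every integer $k\ge 3$, every satellite graph $S_{2k+1}$ is a nut graph.
   Context: For an integer $k\ge3$, a satellite graph $S_{2k+1}$ is a simple graph on $2k+1$ vertices whose vertex set is partitioned into a single vertex $v_{\mathrm{dom}}$, a set $V_4=\{u_1,\dots,u_k\}$ and a set $V_2=\{w_1,\dots,w_k\}$, with edges as follows: $v_{\mathrm{dom}}$ is adjacent to every other vertex; each vertex of $V_4$ is adjacent to exactly two vertices of $V_4$ and exactly one vertex of $V_2$; each vertex of $V_2$ is adjacent to exactly one vertex of $V_4$ (and to $v_{\mathrm{dom}}$); there are no other edges. (So vertices of $V_4$ have degree $4$ and vertices of $V_2$ have degree $2$.) A graph $G$ is a nut graph if its adjacency matrix $A_G$ has nullity $1$ and every nonzero vector in $N(A_G)$ has all coordinates nonzero.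
   Formalization: The null space $N(A_G)$ of the adjacency matrix and its vectors are taken over the rationals rather than the reals. -}

module Defs where

open import Data.Nat using (ℕ; zero; suc; _≤_)
open import Data.Fin using (Fin; zero; suc)
open import Data.Bool using (Bool; true; false; if_then_else_)
open import Data.Rational using (ℚ; 0ℚ; 1ℚ; _+_; _*_)
open import Data.Product using (Σ; ∃; ∃-syntax; _×_; _,_)
open import Data.Sum using (_⊎_)
open import Relation.Binary.PropositionalEquality using (_≡_)
open import Relation.Nullary using (¬_)
open import Function.Bundles using (_⇔_)
open import Function.Definitions using (Injective)

record SimpleGraph (n : ℕ) : Set where
  field
    Adj   : Fin n → Fin n → Bool
    sym   : ∀ i j → Adj i j ≡ Adj j i
    irrfl : ∀ i → Adj i i ≡ false
open SimpleGraph public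

∑ : ∀ {n} → (Fin n → ℚ) → ℚ
∑ {zero}  f = 0ℚ
∑ {suc n} f = f zero + ∑ (λ i → f (suc i))

adjMatrix : ∀ {n} → SimpleGraph n → Fin n → Fin n → ℚ
adjMatrix G i j = if Adj G i j then 1ℚ else 0ℚ

InNullSpace : ∀ {n} → SimpleGraph n → (Fin n → ℚ) → Set
InNullSpace G x = ∀ i → ∑ (λ j → adjMatrix G i j * x j) ≡ 0ℚ

NonzeroVec : ∀ {n} → (Fin n → ℚ) → Set
NonzeroVec {n} x = ∃[ i ] ¬ (x i ≡ 0ℚ)

Nullity1 : ∀ {n} → SimpleGraph n → Set
Nullity1 {n} G =
  ∃[ x ] (NonzeroVec x × InNullSpace G x ×
          (∀ y → InNullSpace G y → ∃[ c ] (∀ i → y i ≡ c * x i)))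

IsNutGraph : ∀ {n} → SimpleGraph n → Set
IsNutGraph {n} G =
  Nullity1 G ×
  (∀ x → InNullSpace G x → NonzeroVec x → ∀ i → ¬ (x i ≡ 0ℚ))

ExactlyOne : ∀ {k} → (Fin k → Set) → Set
ExactlyOne {k} P = ∃[ a ] (∀ j → P j ⇔ (j ≡ a))

ExactlyTwo : ∀ {k} → (Fin k → Set) → Set
ExactlyTwo {k} P = ∃[ a ] ∃[ b ] (¬ (a ≡ b) × (∀ j → P j ⇔ (j ≡ a ⊎ j ≡ b)))

-- G on Fin n is a satellite graph with parameter k (n = 2k+1), with vertex
-- partition {d} ∪ V4 ∪ V2 where V4 = image of u, V2 = image of w.
record IsSatellite (k : ℕ) {n : ℕ} (G : SimpleGraph n) : Set where
  field
    d : Fin n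
    u : Fin k → Fin n
    w : Fin k → Fin n
    u-inj  : Injective _≡_ _≡_ u
    w-inj  : Injective _≡_ _≡_ w
    u≢d    : ∀ i → ¬ (u i ≡ d)
    w≢d    : ∀ i → ¬ (w i ≡ d)
    u≢w    : ∀ i j → ¬ (u i ≡ w j)
    cover  : ∀ v → v ≡ d ⊎ (∃[ i ] v ≡ u i) ⊎ (∃[ i ] v ≡ w i)
    dom    : ∀ v → ¬ (v ≡ d) → Adj G d v ≡ true
    uu     : ∀ i → ExactlyTwo (λ j → Adj G (u i) (u j) ≡ true)
    uw     : ∀ i → ExactlyOne (λ j → Adj G (u i) (w j) ≡ true)
    wu     : ∀ i → ExactlyOne (λ j → Adj G (w i) (u j) ≡ true)
    ww     : ∀ i j → Adj G (w i) (w j) ≡ false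

-- Let x be 1 at d, −1 on V4 and 1 on V2. Each V4 row of A x sums 1 − 1 − 1 + 1 and each V2 row
-- 1 − 1; in the row of d the perfect matching between V4 and V2 cancels the entries in pairs.
-- Conversely, for a null vector y the V2 rows force y = −y(d) on V4, and then the V4 rows force
-- y = y(d) on V2, so y = y(d)·x. Since every entry of x is ±1, N(A) is spanned by a full vector.
module Submission where

open import Defs hiding (sym)
open import Data.Nat using (ℕ; suc; _+_; _≤_)
open import Data.Fin using (Fin; zero; suc; punchIn)
open import Data.Fin.Properties using (_≟_; punchInᵢ≢i)
open import Data.Fin.Permutation using (permutation)
open import Data.Bool using (true; false; if_then_else_)
open import Data.Rational using (ℚ; 0ℚ; 1ℚ; -_; ½)
  renaming (_+_ to _+ℚ_; _*_ to _*ℚ_)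
import Data.Rational.Properties as ℚ
open import Data.Rational.Solver using (module +-*-Solver)
open import Algebra.Properties.CommutativeMonoid.Sum ℚ.+-0-commutativeMonoid
  using (sum; sum-cong-≗; sum-remove; sum-permute; ∑-distrib-+; sum-replicate-zero)
open import Algebra.Properties.Group ℚ.+-0-group using (inverseʳ-unique; ⁻¹-involutive)
open import Data.List using (List; []; _∷_)
open import Data.List.Membership.Propositional using (_∈_; _∉_)
open import Data.List.Relation.Unary.Any using (here; there)
open import Data.List.Relation.Unary.All as All using (All; []; _∷_)
open import Data.List.Relation.Unary.Unique.Propositional using (Unique)
open import Data.List.Relation.Unary.AllPairs using ([]; _∷_)
open import Data.Product using (∃-syntax; _,_; proj₁; proj₂)
open import Data.Sum using (inj₁; inj₂)
open import Function using (_∘_)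
open import Function.Bundles using (Equivalence)
open import Relation.Binary.PropositionalEquality
  using (_≡_; _≢_; refl; sym; trans; cong; cong₂; module ≡-Reasoning)
open import Relation.Nullary using (yes; no; does; contradiction)

open ≡-Reasoning

double≡0⇒≡0 : ∀ s → s +ℚ s ≡ 0ℚ → s ≡ 0ℚ
double≡0⇒≡0 s s+s≡0 = begin
  s                ≡⟨ solve 1 (λ s → s := con ½ :* (s :+ s)) refl s ⟩
  ½ *ℚ (s +ℚ s)    ≡⟨ cong (½ *ℚ_) s+s≡0 ⟩
  ½ *ℚ 0ℚ          ≡⟨ ℚ.*-zeroʳ ½ ⟩
  0ℚ               ∎
  where open +-*-Solver

∑≡sum : ∀ {n} (f : Fin n → ℚ) → ∑ f ≡ sum f
∑≡sum {ℕ.zero} f = refl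
∑≡sum {suc n}  f = cong (f zero +ℚ_) (∑≡sum (f ∘ suc))

sum-odd-involution≡0 : ∀ {n} (f : Fin n → ℚ) (σ : Fin n → Fin n) →
  (∀ i → σ (σ i) ≡ i) → (∀ i → f (σ i) +ℚ f i ≡ 0ℚ) → sum f ≡ 0ℚ
sum-odd-involution≡0 {n} f σ σσ≡id f∘σ+f≡0 = double≡0⇒≡0 (sum f) (begin
  sum f +ℚ sum f                 ≡⟨ cong (_+ℚ sum f) (sum-permute f σ-permutation) ⟩
  sum (f ∘ σ) +ℚ sum f           ≡⟨ sym (∑-distrib-+ (f ∘ σ) f) ⟩
  sum (λ i → f (σ i) +ℚ f i)     ≡⟨ sum-cong-≗ f∘σ+f≡0 ⟩
  sum {n} (λ _ → 0ℚ)             ≡⟨ sum-replicate-zero n ⟩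
  0ℚ                             ∎)
  where σ-permutation = permutation σ σ σσ≡id σσ≡id

clearAt : ∀ {n} → Fin n → (Fin n → ℚ) → Fin n → ℚ
clearAt s f j = if does (j ≟ s) then 0ℚ else f j

clearAt-self : ∀ {n} (s : Fin n) f → clearAt s f s ≡ 0ℚ
clearAt-self s f with s ≟ s
... | yes _   = refl
... | no s≢s  = contradiction refl s≢s

clearAt-≢ : ∀ {n} {s j : Fin n} f → j ≢ s → clearAt s f j ≡ f j
clearAt-≢ {s = s} {j} f j≢s with j ≟ s
... | yes j≡s = contradiction j≡s j≢s
... | no _    = refl

sum-clearAt : ∀ {n} (s : Fin n) f → sum f ≡ f s +ℚ sum (clearAt s f)
sum-clearAt {suc n} s f = begin
  sum f                       ≡⟨ sum-remove {i = s} f ⟩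
  f s +ℚ sum (f ∘ punchIn s)  ≡⟨ cong (f s +ℚ_) rest ⟩
  f s +ℚ sum (clearAt s f)    ∎
  where
  g = clearAt s f
  rest : sum (f ∘ punchIn s) ≡ sum g
  rest = begin
    sum (f ∘ punchIn s)          ≡⟨ sum-cong-≗ (λ j → sym (clearAt-≢ f (punchInᵢ≢i s j))) ⟩
    sum (g ∘ punchIn s)          ≡⟨ sym (ℚ.+-identityˡ _) ⟩
    0ℚ +ℚ sum (g ∘ punchIn s)    ≡⟨ cong (_+ℚ sum (g ∘ punchIn s)) (sym (clearAt-self s f)) ⟩
    g s +ℚ sum (g ∘ punchIn s)   ≡⟨ sym (sum-remove {i = s} g) ⟩
    sum g                        ∎

sumMap : ∀ {a} {A : Set a} → (A → ℚ) → List A → ℚ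
sumMap f []       = 0ℚ
sumMap f (s ∷ ss) = f s +ℚ sumMap f ss

sumMap-cong : ∀ {a} {A : Set a} {f g : A → ℚ} {ss : List A} →
  All (λ s → f s ≡ g s) ss → sumMap f ss ≡ sumMap g ss
sumMap-cong []         = refl
sumMap-cong (p ∷ ps)   = cong₂ _+ℚ_ p (sumMap-cong ps)

sum-support : ∀ {n} (f : Fin n → ℚ) (ss : List (Fin n)) → Unique ss →
  (∀ j → j ∉ ss → f j ≡ 0ℚ) → sum f ≡ sumMap f ss
sum-support {n} f [] [] f≡0 = trans (sum-cong-≗ (λ j → f≡0 j λ ())) (sum-replicate-zero n)
sum-support f (s ∷ ss) (s∉ss ∷ ss-unique) f≡0 = begin
  sum f                           ≡⟨ sum-clearAt s f ⟩
  f s +ℚ sum (clearAt s f)        ≡⟨ cong (f s +ℚ_) (sum-support _ ss ss-unique cleared≡0) ⟩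
  f s +ℚ sumMap (clearAt s f) ss  ≡⟨ cong (f s +ℚ_) (sumMap-cong (All.map cleared≡f s∉ss)) ⟩
  f s +ℚ sumMap f ss              ∎
  where
  cleared≡0 : ∀ j → j ∉ ss → clearAt s f j ≡ 0ℚ
  cleared≡0 j j∉ss with j ≟ s
  ... | yes _  = refl
  ... | no j≢s = f≡0 j λ { (here j≡s) → j≢s j≡s ; (there j∈ss) → j∉ss j∈ss }
  cleared≡f : ∀ {t} → s ≢ t → clearAt s f t ≡ f t
  cleared≡f s≢t = clearAt-≢ f (s≢t ∘ sym)

adjMul : ∀ {n} → SimpleGraph n → (Fin n → ℚ) → Fin n → ℚ
adjMul G y v = ∑ (λ j → adjMatrix G v j *ℚ y j)

adjMul-neighbours : ∀ {n} (G : SimpleGraph n) y v (ns : List (Fin n)) → Unique ns →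
  All (λ j → Adj G v j ≡ true) ns → (∀ j → Adj G v j ≡ true → j ∈ ns) →
  adjMul G y v ≡ sumMap y ns
adjMul-neighbours G y v ns ns-unique adjacent complete = begin
  adjMul G y v                              ≡⟨ ∑≡sum (λ j → adjMatrix G v j *ℚ y j) ⟩
  sum (λ j → adjMatrix G v j *ℚ y j)        ≡⟨ sum-support _ ns ns-unique non-neighbour≡0 ⟩
  sumMap (λ j → adjMatrix G v j *ℚ y j) ns  ≡⟨ sumMap-cong (All.map neighbour≡y adjacent) ⟩
  sumMap y ns                               ∎
  where
  non-neighbour≡0 : ∀ j → j ∉ ns → adjMatrix G v j *ℚ y j ≡ 0ℚ
  non-neighbour≡0 j j∉ns with Adj G v j in vj
  ... | true  = contradiction (complete j vj) j∉ns
  ... | false = ℚ.*-zeroˡ (y j)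
  neighbour≡y : ∀ {j} → Adj G v j ≡ true → adjMatrix G v j *ℚ y j ≡ y j
  neighbour≡y {j} vj rewrite vj = ℚ.*-identityˡ (y j)

signKernel⇒isNutGraph : ∀ {n} (G : SimpleGraph (suc n)) (x : Fin (suc n) → ℚ) →
  (∀ i → x i *ℚ x i ≡ 1ℚ) → InNullSpace G x →
  (∀ y → InNullSpace G y → ∃[ c ] (∀ i → y i ≡ c *ℚ x i)) → IsNutGraph G
signKernel⇒isNutGraph G x x²≡1 x-null spans =
  (x , (zero , x₀≢0) , x-null , spans) , full
  where
  x₀≢0 : x zero ≢ 0ℚ
  x₀≢0 x₀≡0 = ℚ.1≢0 (trans (sym (x²≡1 zero)) (cong (λ t → t *ℚ t) x₀≡0))
  full : ∀ y → InNullSpace G y → NonzeroVec y → ∀ i → y i ≢ 0ℚ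
  full y y-null (j , yj≢0) i yi≡0 = yj≢0 (begin
    y j          ≡⟨ y≡cx j ⟩
    c *ℚ x j     ≡⟨ cong (_*ℚ x j) c≡0 ⟩
    0ℚ *ℚ x j    ≡⟨ ℚ.*-zeroˡ (x j) ⟩
    0ℚ           ∎)
    where
    c = proj₁ (spans y y-null)
    y≡cx = proj₂ (spans y y-null)
    c≡0 : c ≡ 0ℚ
    c≡0 = begin
      c                     ≡⟨ sym (ℚ.*-identityʳ c) ⟩
      c *ℚ 1ℚ               ≡⟨ cong (c *ℚ_) (sym (x²≡1 i)) ⟩
      c *ℚ (x i *ℚ x i)     ≡⟨ sym (ℚ.*-assoc c (x i) (x i)) ⟩
      (c *ℚ x i) *ℚ x i     ≡⟨ cong (_*ℚ x i) (trans (sym (y≡cx i)) yi≡0) ⟩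
      0ℚ *ℚ x i             ≡⟨ ℚ.*-zeroˡ (x i) ⟩
      0ℚ                    ∎

module Satellite {k : ℕ} {G : SimpleGraph (suc (k + k))} (S : IsSatellite k G) where
  open IsSatellite S
  open Equivalence using (to; from)

  V : Set
  V = Fin (suc (k + k))

  vertex-ind : {P : V → Set} → P d → (∀ i → P (u i)) → (∀ i → P (w i)) → ∀ v → P v
  vertex-ind pd pu pw v with cover v
  ... | inj₁ refl              = pd
  ... | inj₂ (inj₁ (i , refl)) = pu i
  ... | inj₂ (inj₂ (i , refl)) = pw i

  -- Unlike vertex-ind, whose values at u i and w i are stuck on the opaque proof cover v,
  -- this eliminator provably computes on each class (byClass-d, byClass-u, byClass-w).
  byClass : ∀ {a} {A : Set a} → A → (Fin k → A) → (Fin k → A) → V → A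
  byClass a f g v with cover v
  ... | inj₁ _              = a
  ... | inj₂ (inj₁ (i , _)) = f i
  ... | inj₂ (inj₂ (i , _)) = g i

  module _ {a} {A : Set a} {c : A} {f g : Fin k → A} where
    byClass-d : byClass c f g d ≡ c
    byClass-d with cover d
    ... | inj₁ _              = refl
    ... | inj₂ (inj₁ (i , e)) = contradiction (sym e) (u≢d i)
    ... | inj₂ (inj₂ (i , e)) = contradiction (sym e) (w≢d i)

    byClass-u : ∀ i → byClass c f g (u i) ≡ f i
    byClass-u i with cover (u i)
    ... | inj₁ e              = contradiction e (u≢d i)
    ... | inj₂ (inj₁ (j , e)) = cong f (sym (u-inj e))
    ... | inj₂ (inj₂ (j , e)) = contradiction e (u≢w i j)

    byClass-w : ∀ i → byClass c f g (w i) ≡ g i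
    byClass-w i with cover (w i)
    ... | inj₁ e              = contradiction e (w≢d i)
    ... | inj₂ (inj₁ (j , e)) = contradiction (sym e) (u≢w j i)
    ... | inj₂ (inj₂ (j , e)) = cong g (sym (w-inj e))

  adj-sym : ∀ {a b} → Adj G a b ≡ true → Adj G b a ≡ true
  adj-sym {a} {b} ab = trans (SimpleGraph.sym G b a) ab

  adj-d : ∀ v → v ≢ d → Adj G v d ≡ true
  adj-d v v≢d = adj-sym (dom v v≢d)

  d≢u : ∀ i → d ≢ u i
  d≢u i = u≢d i ∘ sym

  d≢w : ∀ i → d ≢ w i
  d≢w i = w≢d i ∘ sym

  pendant : Fin k → Fin k
  pendant i = proj₁ (uw i)

  anchor : Fin k → Fin k
  anchor m = proj₁ (wu m)

  adj-pendant : ∀ i → Adj G (u i) (w (pendant i)) ≡ true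
  adj-pendant i = from (proj₂ (uw i) (pendant i)) refl

  adj-anchor : ∀ m → Adj G (w m) (u (anchor m)) ≡ true
  adj-anchor m = from (proj₂ (wu m) (anchor m)) refl

  anchor-pendant : ∀ i → anchor (pendant i) ≡ i
  anchor-pendant i = sym (to (proj₂ (wu (pendant i)) i) (adj-sym (adj-pendant i)))

  pendant-anchor : ∀ m → pendant (anchor m) ≡ m
  pendant-anchor m = sym (to (proj₂ (uw (anchor m)) m) (adj-sym (adj-anchor m)))

  cycleNbr₁ cycleNbr₂ : Fin k → Fin k
  cycleNbr₁ i = proj₁ (uu i)
  cycleNbr₂ i = proj₁ (proj₂ (uu i))

  adjMul-w : ∀ y m → adjMul G y (w m) ≡ y d +ℚ (y (u (anchor m)) +ℚ 0ℚ)
  adjMul-w y m = adjMul-neighbours G y (w m) (d ∷ u (anchor m) ∷ [])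
    ((d≢u (anchor m) ∷ []) ∷ [] ∷ [])
    (adj-d (w m) (w≢d m) ∷ adj-anchor m ∷ [])
    complete
    where
    complete : ∀ j → Adj G (w m) j ≡ true → j ∈ d ∷ u (anchor m) ∷ []
    complete j wm~j with cover j
    ... | inj₁ refl              = here refl
    ... | inj₂ (inj₁ (i , refl)) = there (here (cong u (to (proj₂ (wu m) i) wm~j)))
    ... | inj₂ (inj₂ (i , refl)) = contradiction (trans (sym wm~j) (ww m i)) λ ()

  adjMul-u : ∀ y i → adjMul G y (u i) ≡
    y d +ℚ (y (u (cycleNbr₁ i)) +ℚ (y (u (cycleNbr₂ i)) +ℚ (y (w (pendant i)) +ℚ 0ℚ)))
  adjMul-u y i with uu i
  ... | p , q , p≢q , nbr⇔ = adjMul-neighbours G y (u i) (d ∷ u p ∷ u q ∷ w (pendant i) ∷ [])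
    ((d≢u p ∷ d≢u q ∷ d≢w (pendant i) ∷ [])
     ∷ ((λ e → p≢q (u-inj e)) ∷ u≢w p (pendant i) ∷ [])
     ∷ (u≢w q (pendant i) ∷ [])
     ∷ [] ∷ [])
    (adj-d (u i) (u≢d i) ∷ from (nbr⇔ p) (inj₁ refl) ∷ from (nbr⇔ q) (inj₂ refl)
      ∷ adj-pendant i ∷ [])
    complete
    where
    complete : ∀ j → Adj G (u i) j ≡ true → j ∈ d ∷ u p ∷ u q ∷ w (pendant i) ∷ []
    complete j ui~j with cover j
    ... | inj₁ refl              = here refl
    ... | inj₂ (inj₂ (t , refl)) = there (there (there (here (cong w (to (proj₂ (uw i) t) ui~j)))))
    ... | inj₂ (inj₁ (t , refl)) with to (nbr⇔ t) ui~j
    ...   | inj₁ t≡p = there (here (cong u t≡p))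
    ...   | inj₂ t≡q = there (there (here (cong u t≡q)))

  x : V → ℚ
  x = byClass 1ℚ (λ _ → - 1ℚ) (λ _ → 1ℚ)

  x-d : x d ≡ 1ℚ
  x-d = byClass-d

  x-u : ∀ i → x (u i) ≡ - 1ℚ
  x-u = byClass-u

  x-w : ∀ i → x (w i) ≡ 1ℚ
  x-w = byClass-w

  x²≡1 : ∀ v → x v *ℚ x v ≡ 1ℚ
  x²≡1 = vertex-ind
    (cong (λ t → t *ℚ t) x-d)
    (λ i → cong (λ t → t *ℚ t) (x-u i))
    (λ i → cong (λ t → t *ℚ t) (x-w i))

  swap : V → V
  swap = byClass d (w ∘ pendant) (u ∘ anchor)

  swap-involutive : ∀ v → swap (swap v) ≡ v
  swap-involutive = vertex-ind
    (trans (cong swap byClass-d) byClass-d)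
    (λ i → trans (cong swap (byClass-u i)) (trans (byClass-w (pendant i)) (cong u (anchor-pendant i))))
    (λ m → trans (cong swap (byClass-w m)) (trans (byClass-u (anchor m)) (cong w (pendant-anchor m))))

  dRow : V → ℚ
  dRow v = adjMatrix G d v *ℚ x v

  dRow-d : dRow d ≡ 0ℚ
  dRow-d rewrite irrfl G d = ℚ.*-zeroˡ (x d)

  dRow-u : ∀ i → dRow (u i) ≡ - 1ℚ
  dRow-u i rewrite dom (u i) (u≢d i) | x-u i = refl

  dRow-w : ∀ i → dRow (w i) ≡ 1ℚ
  dRow-w i rewrite dom (w i) (w≢d i) | x-w i = refl

  dRow-swap : ∀ v → dRow (swap v) +ℚ dRow v ≡ 0ℚ
  dRow-swap = vertex-ind
    (cong₂ _+ℚ_ (trans (cong dRow byClass-d) dRow-d) dRow-d)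
    (λ i → cong₂ _+ℚ_ (trans (cong dRow (byClass-u i)) (dRow-w (pendant i))) (dRow-u i))
    (λ m → cong₂ _+ℚ_ (trans (cong dRow (byClass-w m)) (dRow-u (anchor m))) (dRow-w m))

  x-null : InNullSpace G x
  x-null = vertex-ind x-null-d x-null-u x-null-w
    where
    -- The row of d pairs each u i with its pendant vertex, where x takes opposite values.
    x-null-d : adjMul G x d ≡ 0ℚ
    x-null-d = trans (∑≡sum dRow) (sum-odd-involution≡0 dRow swap swap-involutive dRow-swap)
    x-null-u : ∀ i → adjMul G x (u i) ≡ 0ℚ
    x-null-u i rewrite adjMul-u x i | x-d | x-u (cycleNbr₁ i) | x-u (cycleNbr₂ i) | x-w (pendant i) = refl
    x-null-w : ∀ m → adjMul G x (w m) ≡ 0ℚ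
    x-null-w m rewrite adjMul-w x m | x-d | x-u (anchor m) = refl

  module _ (y : V → ℚ) (y-null : InNullSpace G y) where
    y-u : ∀ i → y (u i) ≡ - y d
    y-u i = inverseʳ-unique (y d) (y (u i)) (begin
      y d +ℚ y (u i)                             ≡⟨ cong (λ t → y d +ℚ y (u t)) (sym (anchor-pendant i)) ⟩
      y d +ℚ y (u (anchor (pendant i)))          ≡⟨ cong (y d +ℚ_) (sym (ℚ.+-identityʳ _)) ⟩
      y d +ℚ (y (u (anchor (pendant i))) +ℚ 0ℚ)  ≡⟨ sym (adjMul-w y (pendant i)) ⟩
      adjMul G y (w (pendant i))                 ≡⟨ y-null (w (pendant i)) ⟩
      0ℚ                                         ∎)

    y-pendant : ∀ i → y (w (pendant i)) ≡ y d
    y-pendant i = begin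
      z      ≡⟨ inverseʳ-unique (- c) z -c+z≡0 ⟩
      - - c  ≡⟨ ⁻¹-involutive c ⟩
      c      ∎
      where
      open +-*-Solver
      c = y d
      z = y (w (pendant i))
      p = cycleNbr₁ i
      q = cycleNbr₂ i
      -c+z≡0 : - c +ℚ z ≡ 0ℚ
      -c+z≡0 = begin
        - c +ℚ z
          ≡⟨ solve 2 (λ c z → :- c :+ z := c :+ (:- c :+ (:- c :+ (z :+ con 0ℚ)))) refl c z ⟩
        c +ℚ (- c +ℚ (- c +ℚ (z +ℚ 0ℚ)))
          ≡⟨ cong₂ (λ s t → c +ℚ (s +ℚ (t +ℚ (z +ℚ 0ℚ)))) (sym (y-u p)) (sym (y-u q)) ⟩
        c +ℚ (y (u p) +ℚ (y (u q) +ℚ (z +ℚ 0ℚ)))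
          ≡⟨ sym (adjMul-u y i) ⟩
        adjMul G y (u i)
          ≡⟨ y-null (u i) ⟩
        0ℚ
          ∎

    y≡y[d]*x : ∀ v → y v ≡ y d *ℚ x v
    y≡y[d]*x = vertex-ind
      (trans (sym (ℚ.*-identityʳ (y d))) (cong (y d *ℚ_) (sym x-d)))
      (λ i → trans (y-u i) (trans (solve 1 (λ c → :- c := c :* con (- 1ℚ)) refl (y d))
                                  (cong (y d *ℚ_) (sym (x-u i)))))
      (λ m → trans (cong (y ∘ w) (sym (pendant-anchor m)))
                   (trans (y-pendant (anchor m))
                          (trans (sym (ℚ.*-identityʳ (y d))) (cong (y d *ℚ_) (sym (x-w m))))))
      where open +-*-Solver

  isNutGraph : IsNutGraph G
  isNutGraph = signKernel⇒isNutGraph G x x²≡1 x-null (λ y y-null → y d , y≡y[d]*x y y-null)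

-- The hypothesis k ≥ 3 is only needed for satellite graphs to exist (V4 spans a 2-regular graph).
theorem4p2 : (k : ℕ) → 3 ≤ k → (G : SimpleGraph (suc (k + k))) →
    IsSatellite k G → IsNutGraph G
theorem4p2 k _ G S = Satellite.isNutGraph S
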